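{- Let $C$ be the applicability condition of an inference rule in a well-behaved defeasible logic. Then $\mathrm{sneg}(\mathrm{sneg}(C))\rightarrow C$ is proof-valid.
   Context: A defeasible theory $D=(F,R,>)$ consists of a finite set $F$ of literals, a finite set $R$ of rules (each with a finite antecedent set of literals, a type strict/defeasible/defeater and a consequent literal) and an acyclic relation $>$ on $R$. Conclusions have the form $+d\,q$ or $-d\,q$. A defeasible logic is a finite set of inference rules "We may append $\pm d\,q$ to $P$ if $C$", one per tag; a proof from $D$ is a finite sequence of conclusions each appendable by some rule to the sequence preceding it. An applicability condition $C(D,q,P)$ is a first-order formula in negation normal form (negation only on atomic formulas; connectives $\wedge,\vee,\exists,\forall$) whose atomic formulas are pure atomic formulas (comparisons of elements of $D$, arithmetic and set comparisons; no tagged literals) or proof atomic formulas $\pm d'p\in X$ with $X$ either the current proof $P$ or a pre-defined set of conclusions computed from $D$; $c\notin X$ abbreviates $\neg(c\in X)$. Strong negation: $\mathrm{sneg}(+d p\in X)= -dp\in X$; $\mathrm{sneg}(-dp\in X)=+dp\in X$; $\mathrm{sneg}(+dp\notin X)=+dp\in X$; $\mathrm{sneg}(-dp\notin X)=-dp\in X$; $\mathrm{sneg}(A\wedge B)=\mathrm{sneg}(A)\vee\mathrm{sneg}(B)$; $\mathrm{sneg}(A\vee B)=\mathrm{sneg}(A)\wedge\mathrm{sneg}(B)$; $\mathrm{sneg}(\exists x\,A)=\forall x\,\mathrm{sneg}(A)$; $\mathrm{sneg}(\forall x\,A)=\exists x\,\mathrm{sneg}(A)$; $\mathrm{sneg}(\neg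 A)=A$ and $\mathrm{sneg}(A)=\neg A$ for pure atomic $A$. The logic supports the (revised) Principle of Strong Negation if for every tag $d$, when the $+d$ rule has condition $C$, the $-d$ rule has condition $\mathrm{sneg}(C)$. An inference rule is stable if for every proof $P$ and every proof $Q$ containing $P$ as a subsequence, $C(P)\rightarrow C(Q)$. For a set $J$ of rules with $I$ the smallest set of rules containing $J$ and closed under the rules' references to tags, the $J$-closure is the set of conclusions with tags in $J$ in the smallest set of conclusions closed under inference by rules of $I$; it is even-handed if $J$ contains the $-d$ rule iff it contains the $+d$ rule. A set of conclusions is coherent if it contains no pair $+dq,-dq$. The logic is well-behaved if all its rules are stable, it supports the revised Principle of Strong Negation, and all pre-defined sets used in its rules are coherent even-handed closures. A formula $\psi(D,q,P)$ is proof-valid if it holds for every $D$, every literal $q$ and every proof $P$ from $D$. -}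

module Defs where

open import Level using (Level; _⊔_) renaming (suc to lsuc; zero to lzero)
open import Data.Nat using (ℕ; suc)
open import Data.Fin using (Fin)
open import Data.Vec using (Vec; _∷_; [])
open import Data.List using (List; []; _∷ʳ_; map)
open import Data.List.Membership.Propositional using (_∈_)
open import Data.List.Relation.Unary.Unique.Propositional using (Unique)
open import Data.List.Relation.Binary.Sublist.Propositional using (_⊆_)
open import Data.List.Relation.Unary.Any using (Any)
open import Data.Product using (Σ; _×_; _,_; proj₁; ∃)
open import Data.Sum using (_⊎_)
open import Relation.Nullary using (¬_)
open import Relation.Binary.Construct.Closure.Transitive using (TransClosure)

data Literal : Set where
  pos : ℕ → Literal
  neg : ℕ → Literal

data RuleType : Set where
  strict defeasible defeater : RuleType

record Rule : Set where
  constructor mkRule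
  field
    label      : ℕ
    antecedent : List Literal
    type       : RuleType
    consequent : Literal

_⟨_⟩≻_ : Rule → List (Rule × Rule) → Rule → Set
r ⟨ sup ⟩≻ s = (r , s) ∈ sup

record Theory : Set where
  constructor mkTheory
  field
    F   : List Literal
    R   : List Rule
    sup : List (Rule × Rule)
    sup⊆R   : ∀ {r s} → (r , s) ∈ sup → r ∈ R × s ∈ R
    acyclic : ∀ r → ¬ TransClosure (λ x y → x ⟨ sup ⟩≻ y) r r

data Sign : Set where
  plus minus : Sign

flip : Sign → Sign
flip plus  = minus
flip minus = plus

SignedTag : Set
SignedTag = Sign × ℕ

Conclusion : Set
Conclusion = SignedTag × Literal

-- Domain of quantification of applicability conditions (elements of D etc.)

data Val : Set where
  vLit   : Literal → Val
  vRule  : Rule → Val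
  vNat   : ℕ → Val
  vLits  : List Literal → Val
  vRules : List Rule → Val

PureAtom : ℕ → Set₁
PureAtom n = Theory → Literal → Vec Val n → Set

LitTerm : ℕ → Set
LitTerm n = Theory → Literal → Vec Val n → Literal

-- The set X in a proof atom: the current proof P or the i-th pre-defined set.
data Src (k : ℕ) : Set where
  cur : Src k
  pre : Fin k → Src k

-- Applicability conditions: formulas in negation normal form over k pre-defined sets.
data Formula (k : ℕ) : ℕ → Set₁ where
  pure    : ∀ {n} → PureAtom n → Formula k n
  ¬pure   : ∀ {n} → PureAtom n → Formula k n
  _∈'_    : ∀ {n} → (SignedTag × LitTerm n) → Src k → Formula k n
  _∉'_    : ∀ {n} → (SignedTag × LitTerm n) → Src k → Formula k n
  _∧'_    : ∀ {n} → Formula k n → Formula k n → Formula k n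
  _∨'_    : ∀ {n} → Formula k n → Formula k n → Formula k n
  ∃'      : ∀ {n} → Formula k (suc n) → Formula k n
  ∀'      : ∀ {n} → Formula k (suc n) → Formula k n

sneg : ∀ {k n} → Formula k n → Formula k n
sneg (pure A)             = ¬pure A
sneg (¬pure A)            = pure A
sneg (((s , d) , p) ∈' X) = ((flip s , d) , p) ∈' X
sneg (c ∉' X)             = c ∈' X
sneg (A ∧' B)             = sneg A ∨' sneg B
sneg (A ∨' B)             = sneg A ∧' sneg B
sneg (∃' A)               = ∀' (sneg A)
sneg (∀' A)               = ∃' (sneg A)

Predef : ℕ → Set₁
Predef k = Fin k → Theory → Conclusion → Set

⟦_⟧ : ∀ {k n} → Formula k n → Predef k → Theory → Literal → Vec Val n →
      (Conclusion → Set) → Set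
⟦ pure A ⟧  pd D q ρ P = A D q ρ
⟦ ¬pure A ⟧ pd D q ρ P = ¬ A D q ρ
⟦ (t , p) ∈' cur ⟧   pd D q ρ P = P (t , p D q ρ)
⟦ (t , p) ∈' pre i ⟧ pd D q ρ P = pd i D (t , p D q ρ)
⟦ (t , p) ∉' cur ⟧   pd D q ρ P = ¬ P (t , p D q ρ)
⟦ (t , p) ∉' pre i ⟧ pd D q ρ P = ¬ pd i D (t , p D q ρ)
⟦ A ∧' B ⟧ pd D q ρ P = ⟦ A ⟧ pd D q ρ P × ⟦ B ⟧ pd D q ρ P
⟦ A ∨' B ⟧ pd D q ρ P = ⟦ A ⟧ pd D q ρ P ⊎ ⟦ B ⟧ pd D q ρ P
⟦ ∃' A ⟧ pd D q ρ P = Σ Val λ v → ⟦ A ⟧ pd D q (v ∷ ρ) P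
⟦ ∀' A ⟧ pd D q ρ P = (v : Val) → ⟦ A ⟧ pd D q (v ∷ ρ) P

data Refs {k : ℕ} : ∀ {n} → Formula k n → SignedTag → Set₁ where
  r∈  : ∀ {n t X} {p : LitTerm n} → Refs ((t , p) ∈' X) t
  r∉  : ∀ {n t X} {p : LitTerm n} → Refs ((t , p) ∉' X) t
  r∧ˡ : ∀ {n t} {A B : Formula k n} → Refs A t → Refs (A ∧' B) t
  r∧ʳ : ∀ {n t} {A B : Formula k n} → Refs B t → Refs (A ∧' B) t
  r∨ˡ : ∀ {n t} {A B : Formula k n} → Refs A t → Refs (A ∨' B) t
  r∨ʳ : ∀ {n t} {A B : Formula k n} → Refs B t → Refs (A ∨' B) t
  r∃  : ∀ {n t} {A : Formula k (suc n)} → Refs A t → Refs (∃' A) t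
  r∀  : ∀ {n t} {A : Formula k (suc n)} → Refs A t → Refs (∀' A) t

data Uses {k : ℕ} : ∀ {n} → Formula k n → Fin k → Set₁ where
  u∈  : ∀ {n i c} → Uses {n = n} (c ∈' pre i) i
  u∉  : ∀ {n i c} → Uses {n = n} (c ∉' pre i) i
  u∧ˡ : ∀ {n i} {A B : Formula k n} → Uses A i → Uses (A ∧' B) i
  u∧ʳ : ∀ {n i} {A B : Formula k n} → Uses B i → Uses (A ∧' B) i
  u∨ˡ : ∀ {n i} {A B : Formula k n} → Uses A i → Uses (A ∨' B) i
  u∨ʳ : ∀ {n i} {A B : Formula k n} → Uses B i → Uses (A ∨' B) i
  u∃  : ∀ {n i} {A : Formula k (suc n)} → Uses A i → Uses (∃' A) i
  u∀  : ∀ {n i} {A : Formula k (suc n)} → Uses A i → Uses (∀' A) i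

-- An applicability condition: closed formula (q and D are built in).
Condition : ℕ → Set₁
Condition k = Formula k 0

record Logic (k : ℕ) : Set₁ where
  field
    predef : Predef k
    rules  : List (SignedTag × Condition k)
    oneper : Unique (map proj₁ rules)
open Logic public

holds : ∀ {k} → Logic k → Condition k → Theory → Literal → List Conclusion → Set
holds L C D q P = ⟦ C ⟧ (predef L) D q [] (λ c → c ∈ P)

data IsProof {k} (L : Logic k) (D : Theory) : List Conclusion → Set₁ where
  []ᵖ  : IsProof L D []
  _∷ᵖ_ : ∀ {P t C q} → IsProof L D P → ((t , C) ∈ rules L × holds L C D q P) →
         IsProof L D (P ∷ʳ (t , q))

Stable : ∀ {k} → Logic k → Set₁
Stable L = ∀ {t C} → (t , C) ∈ rules L → ∀ D q (P Q : List Conclusion) →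
  IsProof L D P → IsProof L D Q → P ⊆ Q → holds L C D q P → holds L C D q Q

StrongNegation : ∀ {k} → Logic k → Set₁
StrongNegation L = ∀ d C → ((plus , d) , C) ∈ rules L → ((minus , d) , sneg C) ∈ rules L

data InI {k} (L : Logic k) (J : List SignedTag) : SignedTag → Set₁ where
  base : ∀ {t} → t ∈ J → InI L J t
  step : ∀ {t t' C} → InI L J t → (t , C) ∈ rules L → Refs C t' → InI L J t'

ClosedUnder : ∀ {k} → Logic k → List SignedTag → Theory → (Conclusion → Set) → Set₁
ClosedUnder L J D S = ∀ {t C} → InI L J t → (t , C) ∈ rules L → ∀ q →
  ⟦ C ⟧ (predef L) D q [] S → S (t , q)

Closure : ∀ {k} → Logic k → List SignedTag → Theory → Conclusion → Set₁
Closure L J D c = proj₁ c ∈ J × ((S : Conclusion → Set) → ClosedUnder L J D S → S c)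

EvenHanded : List SignedTag → Set
EvenHanded J = ∀ d → ((plus , d) ∈ J → (minus , d) ∈ J) × ((minus , d) ∈ J → (plus , d) ∈ J)

Coherent : ∀ {ℓ} → (Conclusion → Set ℓ) → Set ℓ
Coherent S = ∀ d q → ¬ (S ((plus , d) , q) × S ((minus , d) , q))

PredefOK : ∀ {k} → Logic k → Set₁
PredefOK {k} L = ∀ (i : Fin k) → (Σ (SignedTag × Condition k) λ r → r ∈ rules L × Uses (proj₂' r) i) →
  Σ (List SignedTag) λ J →
    (∀ {t} → t ∈ J → Σ (Condition k) λ C → (t , C) ∈ rules L) ×
    EvenHanded J ×
    (∀ D c → (predef L i D c → Closure L J D c) × (Closure L J D c → predef L i D c)) ×
    (∀ D → Coherent (Closure L J D))
  where
  proj₂' : SignedTag × Condition k → Condition k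
  proj₂' (_ , C) = C

WellBehaved : ∀ {k} → Logic k → Set₁
WellBehaved L = Stable L × StrongNegation L × PredefOK L

ProofValid : ∀ {k} → Logic k → (Theory → Literal → List Conclusion → Set) → Set₁
ProofValid L ψ = ∀ D q P → IsProof L D P → ψ D q P

-- Strong negation is an involution except on negated proof atoms:
-- sneg (sneg (±d p ∉ X)) is ∓d p ∈ X, which implies ±d p ∉ X exactly when X
-- is coherent.  The pre-defined sets are coherent by assumption.  A proof P is
-- coherent as well: if +d q and −d q both occurred in P, then by stability the
-- condition C of +d and the condition sneg C of −d would hold together at P,
-- and a formula and its strong negation exclude each other over coherent sets.
module Submission where

open import Defs
open import Data.Nat using (ℕ)
open import Data.Vec using (Vec; _∷_; [])
open import Data.Product using (Σ; _×_; _,_; proj₁)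
open import Data.Sum using (inj₁; inj₂)
open import Data.List using (List; _∷_; [_]; _∷ʳ_; map)
open import Data.List.Membership.Propositional using (_∈_)
open import Data.List.Membership.Propositional.Properties using (∈-++⁻; ∈-map⁺)
open import Data.List.Relation.Unary.Any using (here; there)
open import Data.List.Relation.Unary.All using (lookup)
open import Data.List.Relation.Unary.AllPairs using (_∷_)
open import Data.List.Relation.Unary.Unique.Propositional using (Unique)
open import Data.List.Relation.Binary.Sublist.Propositional using (_⊆_; ⊆-refl)
open import Data.List.Relation.Binary.Sublist.Propositional.Properties using (++⁺ʳ)
open import Relation.Nullary using (¬_; contradiction)
open import Relation.Binary.PropositionalEquality using (_≡_; refl; subst)

flip-involutive : ∀ s → flip (flip s) ≡ s
flip-involutive plus  = refl
flip-involutive minus = refl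

xs⊆xs∷ʳx : ∀ {a} {A : Set a} (xs : List A) (x : A) → xs ⊆ xs ∷ʳ x
xs⊆xs∷ʳx xs x = ++⁺ʳ [ x ] ⊆-refl

lookup-functional : ∀ {a b} {A : Set a} {B : Set b} (xs : List (A × B)) →
  Unique (map proj₁ xs) → ∀ {x y y′} → (x , y) ∈ xs → (x , y′) ∈ xs → y ≡ y′
lookup-functional (_ ∷ _)  _        (here refl) (here refl) = refl
lookup-functional (_ ∷ _)  (x∉ ∷ _) (here refl) (there p)   =
  contradiction refl (lookup x∉ (∈-map⁺ proj₁ p))
lookup-functional (_ ∷ _)  (x∉ ∷ _) (there p)   (here refl) =
  contradiction refl (lookup x∉ (∈-map⁺ proj₁ p))
lookup-functional (_ ∷ xs) (_ ∷ u)  (there p)   (there p′)  = lookup-functional xs u p p′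

coherent-flip : ∀ {ℓ} {S : Conclusion → Set ℓ} → Coherent S →
  ∀ s d q → S ((s , d) , q) → ¬ S ((flip s , d) , q)
coherent-flip coh plus  d q x y = coh d q (x , y)
coherent-flip coh minus d q x y = coh d q (y , x)

module _ {k : ℕ} (pd : Predef k) (D : Theory) (q : Literal)
         {S : Conclusion → Set} (S-coherent : Coherent S) where

  sneg-exclusive : ∀ {n} (A : Formula k n) (ρ : Vec Val n) →
    (∀ {i} → Uses A i → Coherent (pd i D)) →
    ⟦ A ⟧ pd D q ρ S → ¬ ⟦ sneg A ⟧ pd D q ρ S
  sneg-exclusive (pure _)                  ρ coh a b = b a
  sneg-exclusive (¬pure _)                 ρ coh a b = a b
  sneg-exclusive (((s , d) , p) ∈' cur)    ρ coh a b =
    coherent-flip {S = S} S-coherent s d (p D q ρ) a b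
  sneg-exclusive (((s , d) , p) ∈' pre i)  ρ coh a b =
    coherent-flip {S = pd i D} (coh u∈) s d (p D q ρ) a b
  sneg-exclusive (_ ∉' cur)                ρ coh a b = a b
  sneg-exclusive (_ ∉' pre _)              ρ coh a b = a b
  sneg-exclusive (A ∧' B) ρ coh (a , _) (inj₁ b) = sneg-exclusive A ρ (λ x → coh (u∧ˡ x)) a b
  sneg-exclusive (A ∧' B) ρ coh (_ , a) (inj₂ b) = sneg-exclusive B ρ (λ x → coh (u∧ʳ x)) a b
  sneg-exclusive (A ∨' B) ρ coh (inj₁ a) (b , _) = sneg-exclusive A ρ (λ x → coh (u∨ˡ x)) a b
  sneg-exclusive (A ∨' B) ρ coh (inj₂ a) (_ , b) = sneg-exclusive B ρ (λ x → coh (u∨ʳ x)) a b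
  sneg-exclusive (∃' A)   ρ coh (v , a) b = sneg-exclusive A (v ∷ ρ) (λ x → coh (u∃ x)) a (b v)
  sneg-exclusive (∀' A)   ρ coh a (v , b) = sneg-exclusive A (v ∷ ρ) (λ x → coh (u∀ x)) (a v) b

  sneg-sneg-elim : ∀ {n} (A : Formula k n) (ρ : Vec Val n) →
    (∀ {i} → Uses A i → Coherent (pd i D)) →
    ⟦ sneg (sneg A) ⟧ pd D q ρ S → ⟦ A ⟧ pd D q ρ S
  sneg-sneg-elim (pure _)                 ρ coh a = a
  sneg-sneg-elim (¬pure _)                ρ coh a = a
  sneg-sneg-elim (((s , d) , p) ∈' X)     ρ coh a =
    subst (λ s′ → ⟦ ((s′ , d) , p) ∈' X ⟧ pd D q ρ S) (flip-involutive s) a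
  sneg-sneg-elim (((s , d) , p) ∉' cur)   ρ coh a b =
    coherent-flip {S = S} S-coherent s d (p D q ρ) b a
  sneg-sneg-elim (((s , d) , p) ∉' pre i) ρ coh a b =
    coherent-flip {S = pd i D} (coh u∉) s d (p D q ρ) b a
  sneg-sneg-elim (A ∧' B) ρ coh (a , b) =
    sneg-sneg-elim A ρ (λ x → coh (u∧ˡ x)) a , sneg-sneg-elim B ρ (λ x → coh (u∧ʳ x)) b
  sneg-sneg-elim (A ∨' B) ρ coh (inj₁ a) = inj₁ (sneg-sneg-elim A ρ (λ x → coh (u∨ˡ x)) a)
  sneg-sneg-elim (A ∨' B) ρ coh (inj₂ b) = inj₂ (sneg-sneg-elim B ρ (λ x → coh (u∨ʳ x)) b)
  sneg-sneg-elim (∃' A)   ρ coh (v , a) = v , sneg-sneg-elim A (v ∷ ρ) (λ x → coh (u∃ x)) a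
  sneg-sneg-elim (∀' A)   ρ coh a v = sneg-sneg-elim A (v ∷ ρ) (λ x → coh (u∀ x)) (a v)

module _ {k : ℕ} (L : Logic k) where

  condition-unique : ∀ {t C C′} → (t , C) ∈ rules L → (t , C′) ∈ rules L → C ≡ C′
  condition-unique = lookup-functional (rules L) (oneper L)

  predef-coherent : PredefOK L → ∀ {t C} → (t , C) ∈ rules L →
    ∀ D {i} → Uses C i → Coherent (predef L i D)
  predef-coherent ok {t} {C} r D {i} u d q (x , y)
    with ok i ((t , C) , r , u)
  ... | _ , _ , _ , predef⇔closure , closure-coherent =
    closure-coherent D d q (proj₁ (predef⇔closure D _) x , proj₁ (predef⇔closure D _) y)

  rule-conditions-exclusive : StrongNegation L → PredefOK L →
    ∀ {D d q C⁺ C⁻} {P : List Conclusion} → Coherent (_∈ P) →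
    ((plus , d) , C⁺) ∈ rules L → ((minus , d) , C⁻) ∈ rules L →
    holds L C⁺ D q P → ¬ holds L C⁻ D q P
  rule-conditions-exclusive strong-negation ok {D} {d} {q} {C⁺} P-coherent r⁺ r⁻ h⁺ h⁻ =
    sneg-exclusive (predef L) D q P-coherent C⁺ [] (predef-coherent ok r⁺ D) h⁺
      (subst (λ C → holds L C D q _) (condition-unique r⁻ (strong-negation d C⁺ r⁺)) h⁻)

  module _ (stable : Stable L) where

    holds-extend : ∀ {D q t C c} {P : List Conclusion} →
      IsProof L D P → IsProof L D (P ∷ʳ c) →
      (t , C) ∈ rules L → holds L C D q P → holds L C D q (P ∷ʳ c)
    holds-extend {D} {q} {c = c} {P} pf pf′ r = stable r D q P (P ∷ʳ c) pf pf′ (xs⊆xs∷ʳx P c)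

    conclusion-justified : ∀ {D t q} {P : List Conclusion} → IsProof L D P → (t , q) ∈ P →
      Σ (Condition k) λ C → (t , C) ∈ rules L × holds L C D q P
    conclusion-justified (_∷ᵖ_ {P = P} pf (r , h)) x∈ with ∈-++⁻ P x∈
    ... | inj₁ x∈P =
      let (C , r′ , h′) = conclusion-justified pf x∈P
      in C , r′ , holds-extend pf (pf ∷ᵖ (r , h)) r′ h′
    ... | inj₂ (here refl) = _ , r , holds-extend pf (pf ∷ᵖ (r , h)) r h

    proof-coherent : StrongNegation L → PredefOK L →
      ∀ {D} {P : List Conclusion} → IsProof L D P → Coherent (_∈ P)
    proof-coherent sn ok (_∷ᵖ_ {P = P} pf (r , h)) d q (x⁺ , x⁻)
      with ∈-++⁻ P x⁺ | ∈-++⁻ P x⁻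
    ... | inj₁ x⁺∈P | inj₁ x⁻∈P = proof-coherent sn ok pf d q (x⁺∈P , x⁻∈P)
    ... | inj₂ (here refl) | inj₁ x⁻∈P =
      let (_ , r⁻ , h⁻) = conclusion-justified pf x⁻∈P
      in rule-conditions-exclusive sn ok (proof-coherent sn ok pf) r r⁻ h h⁻
    ... | inj₁ x⁺∈P | inj₂ (here refl) =
      let (_ , r⁺ , h⁺) = conclusion-justified pf x⁺∈P
      in rule-conditions-exclusive sn ok (proof-coherent sn ok pf) r⁺ r h⁺ h
    ... | inj₂ (here refl) | inj₂ (here ())

corollary3 : ∀ {k : ℕ} (L : Logic k) → WellBehaved L →
    ∀ {t C} → (t , C) ∈ rules L →
    ProofValid L (λ D q P → holds L (sneg (sneg C)) D q P → holds L C D q P)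
corollary3 L (stable , strong-negation , predef-ok) {C = C} r D q P pf =
  sneg-sneg-elim (predef L) D q (proof-coherent L stable strong-negation predef-ok pf) C []
    (predef-coherent L predef-ok r D)
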